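{- Let $w\ge1$ and let $\boldsymbol{\lambda}=\{\lambda_1,\dots,\lambda_k\}$ be a partition of $w$ whose parts satisfy $\lambda_i\le n$. Choose $q$ minimizing $\overline{v}_p(\lambda_q)$ and set $t=\overline{v}_p(\lambda_q)$. Then $v_L(c_{\boldsymbol{\lambda}})\ge i_t^{\pi_L}+w$. If $v_L(c_{\boldsymbol{\lambda}})=i_t^{\pi_L}+w$ and $i_t^{\pi_L}<\infty$, then $\lambda_q=b_t$ and $\lambda_i=b_\nu=n$ for all $i\neq q$.
   Context: $K$ is a field complete with respect to a discrete valuation $v_K$ with perfect residue field of characteristic $p$; $L/K$ is a finite separable totally ramified extension of degree $n=up^\nu$ with $p\nmid u$; $v_L$ is the normalized valuation of $L$ (so $v_L=nv_K$ on $K$). $\pi_L$ is a uniformizer of $L$ with minimal polynomial $f(X)=X^n-c_1X^{n-1}+\dots+(-1)^{n-1}c_{n-1}X+(-1)^nc_n$ over $K$. For a partition $\boldsymbol{\lambda}=\{\lambda_1,\dots,\lambda_k\}$ (multiset of positive integers) with all parts $\le n$, $c_{\boldsymbol{\lambda}}=c_{\lambda_1}\cdots c_{\lambda_k}$. For $k\in\mathbb{Z}$, $\overline{v}_p(k)=\min\{v_p(k),\nu\}$. For $0\le j\le\nu$, $i_j^{\pi_L}=\min\{nv_K(c_h)-h:1\le h\le n,\ \overline{v}_p(h)\le j\}$ (a nonnegative integer or $\infty$). When $i_j^{\pi_L}$ is finite, write $i_j^{\pi_L}=a_jn-b_j$ with $a_j\in\mathbb{Z}$ and $1\le b_j\le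 n$ (note $i_\nu^{\pi_L}=0$ and $b_\nu=n$). -}

module Defs where

open import Level using (Level; _⊔_)
open import Data.Nat as ℕ using (ℕ; zero; suc; _∸_; _^_; _≤_; _<_; _≤?_; NonZero)
open import Data.Nat.DivMod using (_%_)
open import Data.Nat.Divisibility using (_∣_; _∣?_)
open import Data.List using (List; []; _∷_; foldr; map; upTo)
open import Data.Product using (∃; _×_)
open import Relation.Nullary using (¬_; yes; no)
open import Relation.Binary.PropositionalEquality using (_≡_)
open import Algebra.Bundles using (CommutativeRing)

-- Extended naturals ℕ ∪ {∞} (values of valuations of elements which
-- may be zero, and of the invariants i_j).

data ℕ∞ : Set where
  fin : ℕ → ℕ∞
  ∞   : ℕ∞

infixl 6 _+∞_
_+∞_ : ℕ∞ → ℕ∞ → ℕ∞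
fin a +∞ fin b = fin (a ℕ.+ b)
fin _ +∞ ∞     = ∞
∞     +∞ _     = ∞

-- scalar multiplication k · x (used for v_L = n v_K on K, with n ≥ 1)
infixl 7 _·∞_
_·∞_ : ℕ → ℕ∞ → ℕ∞
k ·∞ fin a = fin (k ℕ.* a)
k ·∞ ∞     = ∞

-- x - h  (only applied when x ≥ h, so truncation never occurs)
_∸∞_ : ℕ∞ → ℕ → ℕ∞
fin a ∸∞ h = fin (a ∸ h)
∞     ∸∞ h = ∞

min∞ : ℕ∞ → ℕ∞ → ℕ∞
min∞ (fin a) (fin b) = fin (a ℕ.⊓ b)
min∞ (fin a) ∞       = fin a
min∞ ∞       y       = y

infix 4 _≤∞_
data _≤∞_ : ℕ∞ → ℕ∞ → Set where
  fin≤fin : ∀ {a b} → a ≤ b → fin a ≤∞ fin b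
  _≤∞∞    : ∀ x → x ≤∞ ∞

-- A discrete valuation ring O_K with its normalized valuation
-- v_K : O_K → ℕ ∪ {∞}.  The coefficients c_h of the minimal polynomial of a
-- uniformizer π_L are integral, so they live in O_K.
record DiscreteValuationRing {c ℓ : Level} (R : CommutativeRing c ℓ) : Set (c ⊔ ℓ) where
  open CommutativeRing R
  field
    v          : Carrier → ℕ∞
    v-cong     : ∀ {x y} → x ≈ y → v x ≡ v y
    v-0        : v 0# ≡ ∞
    v-∞        : ∀ x → v x ≡ ∞ → x ≈ 0#
    v-1        : v 1# ≡ fin 0
    v-*        : ∀ x y → v (x * y) ≡ v x +∞ v y
    v-+        : ∀ x y → min∞ (v x) (v y) ≤∞ v (x + y)
    v-unit     : ∀ x → v x ≡ fin 0 → ∃ λ y → x * y ≈ 1#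
    uniformizer : ∃ λ π → v π ≡ fin 1

-- Truncated p-adic valuation  v̄_p(k) = min{v_p(k), ν}
-- (computed as the largest j ≤ ν with p^j ∣ k).

v̄ : (p ν k : ℕ) → ℕ
v̄ p zero    k = zero
v̄ p (suc ν) k with p ^ suc ν ∣? k
... | yes _ = suc ν
... | no  _ = v̄ p ν k

oneTo : ℕ → List ℕ
oneTo n = map suc (upTo n)

module _ {c ℓ : Level} (R : CommutativeRing c ℓ) (V : DiscreteValuationRing R) where
  open CommutativeRing R
  open DiscreteValuationRing V

  iInv : (p ν n : ℕ) (coef : ℕ → Carrier) (j : ℕ) → ℕ∞
  iInv p ν n coef j = foldr step ∞ (oneTo n)
    where
    step : ℕ → ℕ∞ → ℕ∞
    step h acc with v̄ p ν h ≤? j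
    ... | yes _ = min∞ ((n ·∞ v (coef h)) ∸∞ h) acc
    ... | no  _ = acc

  cPart : (coef : ℕ → Carrier) → List ℕ → Carrier
  cPart coef λs = foldr (λ l acc → coef l * acc) 1# λs

-- b for i = a n - b with 1 ≤ b ≤ n

bOf : (n m : ℕ) .{{_ : NonZero n}} → ℕ
bOf n m = n ∸ (m % n)

-- Since v_L(c_λ) = Σᵢ n v_K(c_{λᵢ}), it suffices to bound the summands.  Each
-- n v_K(c_{λᵢ}) is at least λᵢ because v_K(c_h) ≥ 1 and λᵢ ≤ n; the q-th one is
-- at least i_t + λ_q because h = λ_q is admissible in the minimum defining i_t.
-- If the bound is attained, so is every summand bound: then n v_K(c_{λᵢ}) = λᵢ
-- is a multiple of n in [1, n], forcing λᵢ = n, and n v_K(c_{λ_q}) = i_t + λ_q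
-- with 1 ≤ λ_q ≤ n pins λ_q down as b_t.
module Submission where

open import Defs
open import Level using (Level)
open import Data.Nat using (ℕ; suc; _+_; _*_; _^_; _≤_; NonZero)
open import Data.Nat.Divisibility using (_∣_)
open import Data.Nat.Primality using (Prime)
open import Data.List using (List; length; lookup)
open import Data.Nat.ListAction using (sum)
open import Data.List.Relation.Unary.All using (All)
open import Data.Fin using (Fin)
open import Data.Product using (_×_)
open import Relation.Nullary using (¬_)
open import Relation.Binary.PropositionalEquality using (_≡_; _≢_)
open import Algebra.Bundles using (CommutativeRing)

open import Data.Nat using (zero; _≤?_; _∸_)
open import Data.Nat.Properties
open import Algebra.Properties.CommutativeSemigroup +-commutativeSemigroup using (x∙yz≈y∙xz)
open import Data.Nat.DivMod using (_%_; [m+kn]%n≡m%n; m<n⇒m%n≡m)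
open import Data.List using ([]; _∷_; foldr)
open import Data.List.Relation.Unary.All as All using ([]; _∷_)
open import Data.List.Relation.Unary.Any using (here; there)
open import Data.List.Membership.Propositional using (_∈_)
open import Data.List.Membership.Propositional.Properties using (∈-map⁺; ∈-upTo⁺; ∈-lookup)
open import Data.Fin using (zero; suc)
open import Data.Product using (Σ; ∃; _,_; proj₁; proj₂)
open import Relation.Nullary using (yes; no; contradiction)
open import Relation.Binary.PropositionalEquality
  using (refl; sym; trans; cong; subst; module ≡-Reasoning)

+-tight : ∀ {a b x y} → a ≤ x → b ≤ y → x + y ≡ a + b → x ≡ a × y ≡ b
+-tight {a} {b} {x} {y} a≤x b≤y x+y≡a+b =
  x≡a , +-cancelˡ-≡ a y b (trans (cong (_+ y) (sym x≡a)) x+y≡a+b)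
  where
  x≡a : x ≡ a
  x≡a = ≤-antisym (+-cancelʳ-≤ b x a (≤-trans (+-monoʳ-≤ x b≤y) (≤-reflexive x+y≡a+b))) a≤x

multiple-of-n-in-[1,n]≡n : ∀ n a {l} → n * a ≡ l → 1 ≤ l → l ≤ n → l ≡ n
multiple-of-n-in-[1,n]≡n n zero    refl 1≤l _ = contradiction (subst (1 ≤_) (*-zeroʳ n) 1≤l) λ ()
multiple-of-n-in-[1,n]≡n n (suc a) refl _ l≤n = ≤-antisym l≤n (m≤m*n n (suc a))

bOf-unique : ∀ n m a {l} .{{_ : NonZero n}} → n * a ≡ m + l → 1 ≤ l → l ≤ n → l ≡ bOf n m
bOf-unique n m zero {l} na≡m+l 1≤l _ =
  contradiction (subst (1 ≤_) (trans (sym na≡m+l) (*-zeroʳ n)) (≤-trans 1≤l (m≤n+m l m))) λ ()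
bOf-unique n m (suc a) {l} na≡m+l 1≤l l≤n = sym (begin
  n ∸ m % n              ≡⟨ cong (λ k → n ∸ k % n) m≡n∸l+a*n ⟩
  n ∸ (n ∸ l + a * n) % n ≡⟨ cong (n ∸_) ([m+kn]%n≡m%n (n ∸ l) a n) ⟩
  n ∸ (n ∸ l) % n        ≡⟨ cong (n ∸_) (m<n⇒m%n≡m (∸-monoʳ-< {n} {l} {0} 1≤l l≤n)) ⟩
  n ∸ (n ∸ l)            ≡⟨ m∸[m∸n]≡n l≤n ⟩
  l                      ∎)
  where
  open ≡-Reasoning
  m≡n∸l+a*n : m ≡ n ∸ l + a * n
  m≡n∸l+a*n = begin
    m                ≡⟨ m+n∸n≡m m l ⟨
    m + l ∸ l        ≡⟨ cong (_∸ l) (trans (sym na≡m+l) (*-suc n a)) ⟩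
    n + n * a ∸ l    ≡⟨ +-∸-comm (n * a) l≤n ⟩
    n ∸ l + n * a    ≡⟨ cong (n ∸ l +_) (*-comm n a) ⟩
    n ∸ l + a * n    ∎

≤∞-refl : ∀ x → x ≤∞ x
≤∞-refl (fin a) = fin≤fin ≤-refl
≤∞-refl ∞       = ∞ ≤∞∞

≤∞-trans : ∀ {x y z} → x ≤∞ y → y ≤∞ z → x ≤∞ z
≤∞-trans (fin≤fin a≤b) (fin≤fin b≤c) = fin≤fin (≤-trans a≤b b≤c)
≤∞-trans _             (_ ≤∞∞)       = _ ≤∞∞

min∞-≤ˡ : ∀ x y → min∞ x y ≤∞ x
min∞-≤ˡ (fin a) (fin b) = fin≤fin (m⊓n≤m a b)
min∞-≤ˡ (fin a) ∞       = ≤∞-refl _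
min∞-≤ˡ ∞       y       = _ ≤∞∞

min∞-≤ʳ : ∀ x y → min∞ x y ≤∞ y
min∞-≤ʳ (fin a) (fin b) = fin≤fin (m⊓n≤n a b)
min∞-≤ʳ (fin a) ∞       = _ ≤∞∞
min∞-≤ʳ ∞       y       = ≤∞-refl _

+∞-mono-≤∞ : ∀ {x y z w} → x ≤∞ y → z ≤∞ w → x +∞ z ≤∞ y +∞ w
+∞-mono-≤∞ (fin≤fin a≤b) (fin≤fin c≤d) = fin≤fin (+-mono-≤ a≤b c≤d)
+∞-mono-≤∞ {y = fin _} _ (_ ≤∞∞)       = _ ≤∞∞
+∞-mono-≤∞ {y = ∞}     _ _             = _ ≤∞∞

+∞-assoc : ∀ x y z → (x +∞ y) +∞ z ≡ x +∞ (y +∞ z)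
+∞-assoc (fin a) (fin b) (fin c) = cong fin (+-assoc a b c)
+∞-assoc (fin a) (fin b) ∞       = refl
+∞-assoc (fin a) ∞       z       = refl
+∞-assoc ∞       y       z       = refl

+∞-comm : ∀ x y → x +∞ y ≡ y +∞ x
+∞-comm (fin a) (fin b) = cong fin (+-comm a b)
+∞-comm (fin a) ∞       = refl
+∞-comm ∞       (fin b) = refl
+∞-comm ∞       ∞       = refl

fin-injective : ∀ {a b} → fin a ≡ fin b → a ≡ b
fin-injective refl = refl

+∞-tight : ∀ {a b x y} → fin a ≤∞ x → fin b ≤∞ y → x +∞ y ≡ fin (a + b) →
           x ≡ fin a × y ≡ fin b
+∞-tight (fin≤fin a≤x) (fin≤fin b≤y) eq with +-tight a≤x b≤y (fin-injective eq)
... | refl , refl = refl , refl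

·∞-distribˡ-+∞ : ∀ n x y → n ·∞ (x +∞ y) ≡ n ·∞ x +∞ n ·∞ y
·∞-distribˡ-+∞ n (fin a) (fin b) = cong fin (*-distribˡ-+ n a b)
·∞-distribˡ-+∞ n (fin a) ∞       = refl
·∞-distribˡ-+∞ n ∞       y       = refl

·∞≡fin⇒multiple : ∀ n x {k} → n ·∞ x ≡ fin k → ∃ λ a → n * a ≡ k
·∞≡fin⇒multiple n (fin a) refl = a , refl

l≤n⇒l≤∞n·∞x : ∀ {n l x} → fin 1 ≤∞ x → l ≤ n → fin l ≤∞ n ·∞ x
l≤n⇒l≤∞n·∞x {n} (fin≤fin {b = a} 1≤a) l≤n =
  fin≤fin (≤-trans l≤n (≤-trans (≤-reflexive (sym (*-identityʳ n))) (*-monoʳ-≤ n 1≤a)))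
l≤n⇒l≤∞n·∞x (_ ≤∞∞) _ = _ ≤∞∞

x≤∞y∸l⇒x+l≤∞y : ∀ {x y l} → x ≤∞ y ∸∞ l → fin l ≤∞ y → x +∞ fin l ≤∞ y
x≤∞y∸l⇒x+l≤∞y (fin≤fin a≤b∸l) (fin≤fin l≤b) = fin≤fin (m≤o∸n⇒m+n≤o _ l≤b a≤b∸l)
x≤∞y∸l⇒x+l≤∞y {y = ∞} _ _ = _ ≤∞∞

foldr-≤∞ : ∀ {A : Set} (step : A → ℕ∞ → ℕ∞) (e : ℕ∞) {a : A} {xs : List A} {bound : ℕ∞} →
           (∀ b acc → step b acc ≤∞ acc) → (∀ acc → step a acc ≤∞ bound) → a ∈ xs →
           foldr step e xs ≤∞ bound
foldr-≤∞ step e decreasing at-a (here refl) = at-a _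
foldr-≤∞ step e decreasing at-a (there a∈xs) =
  ≤∞-trans (decreasing _ _) (foldr-≤∞ step e decreasing at-a a∈xs)

module _ (D : ℕ → ℕ∞) where

  sum∞ : List ℕ → ℕ∞
  sum∞ = foldr (λ l acc → D l +∞ acc) (fin 0)

  Dominating : List ℕ → Set
  Dominating = All (λ l → fin l ≤∞ D l)

  sum≤∞sum∞ : ∀ {xs} → Dominating xs → fin (sum xs) ≤∞ sum∞ xs
  sum≤∞sum∞ []       = ≤∞-refl _
  sum≤∞sum∞ (d ∷ ds) = +∞-mono-≤∞ d (sum≤∞sum∞ ds)

  sum∞≡sum⇒tight : ∀ {xs} → Dominating xs → sum∞ xs ≡ fin (sum xs) →
                   ∀ i → D (lookup xs i) ≡ fin (lookup xs i)
  sum∞≡sum⇒tight (d ∷ ds) eq zero    = proj₁ (+∞-tight d (sum≤∞sum∞ ds) eq)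
  sum∞≡sum⇒tight (d ∷ ds) eq (suc i) =
    sum∞≡sum⇒tight ds (proj₂ (+∞-tight d (sum≤∞sum∞ ds) eq)) i

  sum∞-excess : ∀ x {xs} → Dominating xs → (q : Fin (length xs)) →
                x +∞ fin (lookup xs q) ≤∞ D (lookup xs q) → x +∞ fin (sum xs) ≤∞ sum∞ xs
  sum∞-excess x {l ∷ xs} (d ∷ ds) zero excess =
    subst (_≤∞ sum∞ (l ∷ xs)) (+∞-assoc x (fin l) (fin (sum xs))) (+∞-mono-≤∞ excess (sum≤∞sum∞ ds))
  sum∞-excess x {l ∷ xs} (d ∷ ds) (suc q) excess =
    subst (_≤∞ sum∞ (l ∷ xs)) shuffle (+∞-mono-≤∞ d (sum∞-excess x ds q excess))
    where
    open ≡-Reasoning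
    shuffle : fin l +∞ (x +∞ fin (sum xs)) ≡ x +∞ fin (l + sum xs)
    shuffle = begin
      fin l +∞ (x +∞ fin (sum xs)) ≡⟨ +∞-assoc (fin l) x _ ⟨
      (fin l +∞ x) +∞ fin (sum xs) ≡⟨ cong (_+∞ fin (sum xs)) (+∞-comm (fin l) x) ⟩
      (x +∞ fin l) +∞ fin (sum xs) ≡⟨ +∞-assoc x (fin l) _ ⟩
      x +∞ fin (l + sum xs)        ∎

  sum∞-excess-tight : ∀ m {xs} → Dominating xs → (q : Fin (length xs)) →
    fin (m + lookup xs q) ≤∞ D (lookup xs q) → sum∞ xs ≡ fin (m + sum xs) →
    D (lookup xs q) ≡ fin (m + lookup xs q) ×
    (∀ i → i ≢ q → D (lookup xs i) ≡ fin (lookup xs i))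
  sum∞-excess-tight m {l ∷ xs} (d ∷ ds) zero excess eq
    with +∞-tight excess (sum≤∞sum∞ ds) (trans eq (cong fin (sym (+-assoc m l (sum xs)))))
  ... | head-tight , tail-tight = head-tight , others
    where
    others : ∀ i → i ≢ zero → D (lookup (l ∷ xs) i) ≡ fin (lookup (l ∷ xs) i)
    others zero    i≢q = contradiction refl i≢q
    others (suc i) _   = sum∞≡sum⇒tight ds tail-tight i
  sum∞-excess-tight m {l ∷ xs} (d ∷ ds) (suc q) excess eq
    with +∞-tight d (sum∞-excess (fin m) ds q excess)
                    (trans eq (cong fin (x∙yz≈y∙xz m l (sum xs))))
  ... | head-tight , tail-tight with sum∞-excess-tight m ds q excess tail-tight
  ... | q-tight , others-tight = q-tight , others
    where
    others : ∀ i → i ≢ suc q → D (lookup (l ∷ xs) i) ≡ fin (lookup (l ∷ xs) i)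
    others zero    _   = head-tight
    others (suc i) i≢q = others-tight i (λ i≡q → i≢q (cong suc i≡q))

module _ {c ℓ : Level} (R : CommutativeRing c ℓ) (V : DiscreteValuationRing R) where
  open CommutativeRing R using (Carrier) renaming (_*_ to _*ᴿ_)
  open DiscreteValuationRing V using (v; v-*; v-1)

  ·∞-v-cPart : ∀ n (coef : ℕ → Carrier) xs →
               n ·∞ v (cPart R V coef xs) ≡ sum∞ (λ l → n ·∞ v (coef l)) xs
  ·∞-v-cPart n coef []       = trans (cong (n ·∞_) v-1) (cong fin (*-zeroʳ n))
  ·∞-v-cPart n coef (l ∷ xs) = begin
    n ·∞ v (coef l *ᴿ cPart R V coef xs)       ≡⟨ cong (n ·∞_) (v-* (coef l) _) ⟩
    n ·∞ (v (coef l) +∞ v (cPart R V coef xs)) ≡⟨ ·∞-distribˡ-+∞ n (v (coef l)) _ ⟩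
    n ·∞ v (coef l) +∞ n ·∞ v (cPart R V coef xs)
      ≡⟨ cong (n ·∞ v (coef l) +∞_) (·∞-v-cPart n coef xs) ⟩
    n ·∞ v (coef l) +∞ sum∞ (λ l → n ·∞ v (coef l)) xs ∎
    where
    open ≡-Reasoning

  -- The step function of the fold defining iInv is local to its where-block;
  -- unification recovers it.
  private
    iInv-as-foldr : ∀ p ν n coef j →
      Σ (ℕ → ℕ∞ → ℕ∞) λ step → iInv R V p ν n coef j ≡ foldr step ∞ (oneTo n)
    iInv-as-foldr p ν n coef j = _ , refl

    iInv-step : ∀ p ν n (coef : ℕ → Carrier) j → ℕ → ℕ∞ → ℕ∞
    iInv-step p ν n coef j = proj₁ (iInv-as-foldr p ν n coef j)

    iInv-step-≤∞-acc : ∀ p ν n coef j h acc → iInv-step p ν n coef j h acc ≤∞ acc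
    iInv-step-≤∞-acc p ν n coef j h acc with v̄ p ν h ≤? j
    ... | yes _ = min∞-≤ʳ _ _
    ... | no  _ = ≤∞-refl acc

    iInv-step-≤∞-term : ∀ p ν n coef j h acc → v̄ p ν h ≤ j →
                        iInv-step p ν n coef j h acc ≤∞ (n ·∞ v (coef h)) ∸∞ h
    iInv-step-≤∞-term p ν n coef j h acc v̄h≤j with v̄ p ν h ≤? j
    ... | yes _    = min∞-≤ˡ _ _
    ... | no  v̄h≰j = contradiction v̄h≤j v̄h≰j

  iInv-≤∞ : ∀ p ν n coef j h → 1 ≤ h → h ≤ n → v̄ p ν h ≤ j →
            iInv R V p ν n coef j ≤∞ (n ·∞ v (coef h)) ∸∞ h
  iInv-≤∞ p ν n coef j (suc k) _ k<n v̄h≤j =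
    foldr-≤∞ (iInv-step p ν n coef j) ∞ (iInv-step-≤∞-acc p ν n coef j)
             (λ acc → iInv-step-≤∞-term p ν n coef j (suc k) acc v̄h≤j)
             (∈-map⁺ suc (∈-upTo⁺ k<n))

-- Only v̄(λ_q) ≤ t is needed.
proposition4p2 : ∀ {c ℓ : Level} (R : CommutativeRing c ℓ) (V : DiscreteValuationRing R)
    (p ν u n : ℕ) .{{_ : NonZero n}} → Prime p → ¬ (p ∣ u) → n ≡ u * p ^ ν →
    (coef : ℕ → CommutativeRing.Carrier R) →
    (∀ h → 1 ≤ h → h ≤ n → fin 1 ≤∞ DiscreteValuationRing.v V (coef h)) →
    DiscreteValuationRing.v V (coef n) ≡ fin 1 →
    (w : ℕ) → 1 ≤ w →
    (λs : List ℕ) → All (λ l → 1 ≤ l × l ≤ n) λs → sum λs ≡ w →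
    (q : Fin (length λs)) →
    (∀ i → v̄ p ν (lookup λs q) ≤ v̄ p ν (lookup λs i)) →
    let t  = v̄ p ν (lookup λs q)
        it = iInv R V p ν n coef t
        vL = n ·∞ DiscreteValuationRing.v V (cPart R V coef λs)
    in (it +∞ fin w ≤∞ vL)
       × (∀ m → it ≡ fin m → vL ≡ fin (m + w) →
            (lookup λs q ≡ bOf n m) × (∀ i → i ≢ q → lookup λs i ≡ n))
proposition4p2 R V p ν _ n _ _ _ coef v[c]≥1 _ _ _ λs λs∈[1,n] refl q _ =
  lower-bound , equality-case
  where
  open DiscreteValuationRing V using (v)
  vL : ℕ → ℕ∞
  vL l = n ·∞ v (coef l)
  dominating : Dominating vL λs
  dominating = All.map (λ (1≤l , l≤n) → l≤n⇒l≤∞n·∞x (v[c]≥1 _ 1≤l l≤n) l≤n) λs∈[1,n]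
  λq : ℕ
  λq = lookup λs q
  λq∈[1,n] : 1 ≤ λq × λq ≤ n
  λq∈[1,n] = All.lookup λs∈[1,n] (∈-lookup q)
  it : ℕ∞
  it = iInv R V p ν n coef (v̄ p ν λq)
  excess : it +∞ fin λq ≤∞ vL λq
  excess = x≤∞y∸l⇒x+l≤∞y (iInv-≤∞ R V p ν n coef _ λq (proj₁ λq∈[1,n]) (proj₂ λq∈[1,n]) ≤-refl)
                         (All.lookup dominating (∈-lookup q))
  vL-cPart : n ·∞ v (cPart R V coef λs) ≡ sum∞ vL λs
  vL-cPart = ·∞-v-cPart R V n coef λs
  lower-bound : it +∞ fin (sum λs) ≤∞ n ·∞ v (cPart R V coef λs)
  lower-bound = subst (it +∞ fin (sum λs) ≤∞_) (sym vL-cPart)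
                      (sum∞-excess vL it dominating q excess)
  tight-part≡n : ∀ i → vL (lookup λs i) ≡ fin (lookup λs i) → lookup λs i ≡ n
  tight-part≡n i tight with ·∞≡fin⇒multiple n _ tight | All.lookup λs∈[1,n] (∈-lookup i)
  ... | a , na≡λi | 1≤λi , λi≤n = multiple-of-n-in-[1,n]≡n n a na≡λi 1≤λi λi≤n
  equality-case : ∀ m → it ≡ fin m → n ·∞ v (cPart R V coef λs) ≡ fin (m + sum λs) →
                  (λq ≡ bOf n m) × (∀ i → i ≢ q → lookup λs i ≡ n)
  equality-case m it≡m vL≡m+w
    with sum∞-excess-tight vL m dominating q (subst (λ x → x +∞ fin λq ≤∞ vL λq) it≡m excess)
                                             (trans (sym vL-cPart) vL≡m+w)
  ... | q-tight , others-tight with ·∞≡fin⇒multiple n _ q-tight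
  ... | a , na≡m+λq = bOf-unique n m a na≡m+λq (proj₁ λq∈[1,n]) (proj₂ λq∈[1,n])
                    , λ i i≢q → tight-part≡n i (others-tight i i≢q)
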